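{- Let $p\ge 1$ and let $k_1,\dots,k_p$ be positive integers. Then $r(k_1,k_2,\dots,k_p)\ge \sum_{i=1}^p k_i-p+1$.
   Context: For a graph whose edges are coloured with colours $1,\dots,p$, a $t$-connected matching in colour $i$ is a connected component of the spanning subgraph formed by the edges of colour $i$ whose maximum matching has size at least $t$. $r(k_1,\dots,k_p)$ denotes the smallest integer $n$ such that every colouring of the edges of $K_{n,n}$ with colours $1,\dots,p$ contains, for some $i$, a $k_i$-connected matching in colour $i$. -}

module Defs where

open import Data.Nat using (ℕ; suc; _∸_; _+_; _≤_)
open import Data.Fin using (Fin)
open import Data.Sum using (_⊎_; inj₁; inj₂)
open import Data.Product using (Σ; ∃; _×_)
open import Data.Vec using (tabulate)
open import Function.Definitions using (Injective)
open import Relation.Binary.PropositionalEquality using (_≡_)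
import Data.Vec as V

-- An edge colouring of K_{n,n} with p colours: left part Fin n, right part Fin n,
-- the edge between left vertex a and right vertex b gets colour c a b.
Colouring : ℕ → ℕ → Set
Colouring n p = Fin n → Fin n → Fin p

-- vertices of K_{n,n}: inj₁ = left side, inj₂ = right side
Vertex : ℕ → Set
Vertex n = Fin n ⊎ Fin n

data Adj {n p : ℕ} (c : Colouring n p) (i : Fin p) : Vertex n → Vertex n → Set where
  lr : ∀ a b → c a b ≡ i → Adj c i (inj₁ a) (inj₂ b)
  rl : ∀ a b → c a b ≡ i → Adj c i (inj₂ b) (inj₁ a)

data Connected {n p : ℕ} (c : Colouring n p) (i : Fin p) : Vertex n → Vertex n → Set where
  here : ∀ {u} → Connected c i u u
  step : ∀ {u v w} → Adj c i u v → Connected c i v w → Connected c i u w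

-- A t-connected matching in colour i: a connected component of the colour-i subgraph
-- (the component of some vertex v) containing a matching of size t, i.e. t
-- pairwise vertex-disjoint colour-i edges (L j, R j), all of whose vertices lie in
-- that component (so the component's maximum matching has size ≥ t).
ConnMatching : {n p : ℕ} → Colouring n p → Fin p → ℕ → Set
ConnMatching {n} c i t =
  Σ (Vertex n) λ v →
  Σ (Fin t → Fin n) λ L →
  Σ (Fin t → Fin n) λ R →
    Injective _≡_ _≡_ L × Injective _≡_ _≡_ R ×
    (∀ j → c (L j) (R j) ≡ i) ×
    (∀ j → Connected c i v (inj₁ (L j)))

Arrows : (n p : ℕ) → (Fin p → ℕ) → Set
Arrows n p k = (c : Colouring n p) → ∃ λ i → ConnMatching c i (k i)

sumK : (p : ℕ) → (Fin p → ℕ) → ℕ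
sumK p k = V.sum (tabulate k)

-- Split the left side of K_{n,n} into blocks, block i having k_i − 1 vertices, which is
-- possible when n ≤ ∑ (k_i − 1), and give every edge the colour of the block of its left
-- endpoint. A matching in colour i then has all its left endpoints in block i, so it has at
-- most k_i − 1 edges: no colour contains a k_i-connected matching.
module Submission where

open import Defs
open import Data.Nat using (ℕ; zero; suc; _∸_; _+_; _≤_)
open import Data.Fin using (Fin)
open import Data.Nat.Properties
  using (+-assoc; +-suc; +-comm; m∸n+n≡m; m+n∸n≡m; ≤-trans; ≤-reflexive; ≰⇒>; n≮n)
open import Data.Fin as Fin using (splitAt; _↑ˡ_; _↑ʳ_; inject≤)
open import Data.Fin.Properties using (splitAt⁻¹-↑ˡ; splitAt⁻¹-↑ʳ; inject≤-injective; injective⇒≤)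
open import Data.Sum using (inj₁; inj₂)
open import Data.Product using (Σ; ∃; _,_; proj₁; map₂)
open import Function using (_∘_)
open import Function.Definitions using (Injective)
open import Relation.Binary.PropositionalEquality
open import Relation.Nullary using (¬_)

Blocks : (p : ℕ) → (Fin p → ℕ) → Set
Blocks p m = Σ (Fin p) (Fin ∘ m)

toBlocks : ∀ p (m : Fin p → ℕ) → Fin (sumK p m) → Blocks p m
toBlocks (suc p) m x with splitAt (m Fin.zero) x
... | inj₁ a = Fin.zero , a
... | inj₂ b with toBlocks p (m ∘ Fin.suc) b
...   | i , y = Fin.suc i , y

fromBlocks : ∀ p (m : Fin p → ℕ) → Blocks p m → Fin (sumK p m)
fromBlocks (suc p) m (Fin.zero  , a) = a ↑ˡ sumK p (m ∘ Fin.suc)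
fromBlocks (suc p) m (Fin.suc i , y) = m Fin.zero ↑ʳ fromBlocks p (m ∘ Fin.suc) (i , y)

fromBlocks-toBlocks : ∀ p (m : Fin p → ℕ) x → fromBlocks p m (toBlocks p m x) ≡ x
fromBlocks-toBlocks (suc p) m x with splitAt (m Fin.zero) x in eq
... | inj₁ a = splitAt⁻¹-↑ˡ eq
... | inj₂ b = trans (cong (m Fin.zero ↑ʳ_) (fromBlocks-toBlocks p (m ∘ Fin.suc) b))
                     (splitAt⁻¹-↑ʳ eq)

toBlocks-injective : ∀ p (m : Fin p → ℕ) → Injective _≡_ _≡_ (toBlocks p m)
toBlocks-injective p m {x} {y} eq = begin
  x                                  ≡⟨ fromBlocks-toBlocks p m x ⟨
  fromBlocks p m (toBlocks p m x)    ≡⟨ cong (fromBlocks p m) eq ⟩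
  fromBlocks p m (toBlocks p m y)    ≡⟨ fromBlocks-toBlocks p m y ⟩
  y                                  ∎
  where open ≡-Reasoning

sumK-∸1 : ∀ p (k : Fin p → ℕ) → (∀ i → 1 ≤ k i) → sumK p k ≡ sumK p (λ i → k i ∸ 1) + p
sumK-∸1 zero    k hk = refl
sumK-∸1 (suc p) k hk = begin
  k₀ + sumK p (k ∘ Fin.suc)     ≡⟨ cong₂ _+_ (sym (m∸n+n≡m (hk Fin.zero)))
                                             (sumK-∸1 p (k ∘ Fin.suc) (hk ∘ Fin.suc)) ⟩
  (k₀ ∸ 1 + 1) + (S + p)        ≡⟨ +-assoc (k₀ ∸ 1) 1 (S + p) ⟩
  k₀ ∸ 1 + suc (S + p)          ≡⟨ cong (k₀ ∸ 1 +_) (+-suc S p) ⟨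
  k₀ ∸ 1 + (S + suc p)          ≡⟨ +-assoc (k₀ ∸ 1) S (suc p) ⟨
  (k₀ ∸ 1 + S) + suc p          ∎
  where
  open ≡-Reasoning
  k₀ = k Fin.zero
  S  = sumK p (λ i → k (Fin.suc i) ∸ 1)

blockColouring : ∀ {n p} {m : Fin p → ℕ} → (Fin n → Blocks p m) → Colouring n p
blockColouring e a _ = proj₁ (e a)

indexInBlock : ∀ {p} {m : Fin p → ℕ} {i} (x : Blocks p m) → proj₁ x ≡ i → Fin (m i)
indexInBlock (_ , y) refl = y

indexInBlock-injective : ∀ {p} {m : Fin p → ℕ} {i} (x y : Blocks p m)
  (x∈i : proj₁ x ≡ i) (y∈i : proj₁ y ≡ i) → indexInBlock x x∈i ≡ indexInBlock y y∈i → x ≡ y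
indexInBlock-injective _ _ refl refl refl = refl

matching≤blockSize : ∀ {n p} {m : Fin p → ℕ} {e : Fin n → Blocks p m} → Injective _≡_ _≡_ e →
  ∀ {i t} → ConnMatching (blockColouring e) i t → t ≤ m i
matching≤blockSize e-inj (_ , L , _ , L-inj , _ , colour , _) =
  injective⇒≤ λ {j} {j′} eq →
    L-inj (e-inj (indexInBlock-injective _ _ (colour j) (colour j′) eq))

Arrows⇒∃k≤m : ∀ {n p} (m k : Fin p → ℕ) → n ≤ sumK p m → Arrows n p k → ∃ λ i → k i ≤ m i
Arrows⇒∃k≤m {n} {p} m k n≤∑m arrows = map₂ (matching≤blockSize e-inj) (arrows (blockColouring e))
  where
  e : Fin n → Blocks p m
  e a = toBlocks p m (inject≤ a n≤∑m)

  e-inj : Injective _≡_ _≡_ e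
  e-inj = inject≤-injective n≤∑m n≤∑m _ _ ∘ toBlocks-injective p m

n≰n∸1 : ∀ {n} → 1 ≤ n → ¬ n ≤ n ∸ 1
n≰n∸1 {suc n} _ = n≮n n

fact2p2 : (p : ℕ) → 1 ≤ p → (k : Fin p → ℕ) → (∀ i → 1 ≤ k i) →
    ∀ n → Arrows n p k → (sumK p k ∸ p) + 1 ≤ n
fact2p2 p _ k hk n arrows = ≤-trans (≤-reflexive (+-comm (sumK p k ∸ p) 1)) (≰⇒> n≰bound)
  where
  bound≡∑k∸1 : sumK p k ∸ p ≡ sumK p (λ i → k i ∸ 1)
  bound≡∑k∸1 = trans (cong (_∸ p) (sumK-∸1 p k hk)) (m+n∸n≡m _ p)

  n≰bound : ¬ n ≤ sumK p k ∸ p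
  n≰bound n≤bound with Arrows⇒∃k≤m (λ i → k i ∸ 1) k (subst (n ≤_) bound≡∑k∸1 n≤bound) arrows
  ... | i , kᵢ≤kᵢ∸1 = n≰n∸1 (hk i) kᵢ≤kᵢ∸1
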